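{- Let $q \geq 7$ be a prime power with $q \equiv 3 \pmod 4$, and let $a, b$ be nonzero elements of $\mathbb{F}_q$ with $(a - 1)(b + 1) \in Q$ and $ab \in Q$. Let $T$ be the $q \times (q+1)$ array defined by \[ T(i, j) = \begin{cases} w_i - \frac{w_i - w_j}{a} & \text{if } j \leq q \text{ and } w_i - w_j \in Q,\\ \left(w_i + \frac{w_i - w_j}{b}\right)' & \text{if } j \leq q \text{ and } w_i - w_j \in N_0,\\ w_i & \text{if } j = q + 1. \end{cases} \] Then $T$ (which is a $(q \times (q+1), 2q)$-triple array) is resolvable.
   Context: Let $\mathbb{F}_q = \{0 = w_1, w_2, \dots, w_q\}$ be the finite field with $q$ elements and $\mathbb{F}_q' = \{w_1', \dots, w_q'\}$ a disjoint copy of it, where $x \mapsto x'$ denotes the copying bijection; the symbol set of $T$ is $\mathbb{F}_q \cup \mathbb{F}_q'$. Let $Q$ be the set of nonzero squares in $\mathbb{F}_q$, $N$ the set of non-squares, and $N_0 = N \cup \{0\}$. An $r \times c$ array is a triple array if no symbol repeats in a row or column, each symbol occurs equally often, any row and column share a constant number of symbols, any two distinct rows share a constant number of symbols, and any two distinct columns share a constant number of symbols; it is known (Preece, Wallis, Yucas) that under the stated hypotheses $T$ is a triple array. For an $r \times c$ triple array with $v$ symbols and replication number $e = rc/v$, let $R_i$ and $C_j$ be the sets of symbols in row $i$ and column $j$. The triple array is called resolvable if $\lambda_{rrc} := \frac{e(e-1)}{r-1}$ and $k := \frac{c}{e}$ are integers and the symbol set can be partitioned into $r$ groups of size $k$ such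 that every $C_j$ contains exactly one symbol from each group, and all symbols of a group lie in exactly the same sets $R_i$. -}

module Defs where

open import Level using (0ℓ)
open import Data.Nat as N using (ℕ; suc; _∸_; _^_; _≤_; _<?_)
open import Data.Nat.Primality using (Prime)
open import Data.Fin using (Fin; fromℕ<; toℕ)
open import Data.Fin.Properties using (any?)
open import Data.Product using (Σ; ∃; ∃-syntax; _×_; _,_; proj₁; ∃!)
open import Data.Sum using (_⊎_; inj₁; inj₂)
open import Function.Bundles using (_⤖_; Bijection; _⇔_)
open import Relation.Nullary using (¬_; Dec; yes; no; ¬?)
open import Relation.Nullary.Decidable using (_×-dec_)
open import Relation.Binary.PropositionalEquality using (_≡_; _≢_; refl)
open import Relation.Binary.Definitions using (DecidableEquality)
open import Algebra.Structures using (IsCommutativeRing)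

IsPrimePower : ℕ → Set
IsPrimePower q = ∃[ p ] ∃[ k ] (Prime p × 1 ≤ k × q ≡ p ^ k)

-- A finite field, with equality being propositional equality,
-- together with an enumeration  w : Fin card ⤖ Carrier  (w_1, ..., w_q).
record FiniteField : Set₁ where
  infixl 6 _+_ _-_
  infixl 7 _*_
  infix  8 -_
  field
    Carrier : Set
    _+_ _*_ : Carrier → Carrier → Carrier
    -_      : Carrier → Carrier
    0# 1#   : Carrier
    _⁻¹     : Carrier → Carrier
    isCommutativeRing : IsCommutativeRing _≡_ _+_ _*_ -_ 0# 1#
    0≢1     : 0# ≢ 1#
    inverseʳ : ∀ x → x ≢ 0# → x * (x ⁻¹) ≡ 1#
    _≟_     : DecidableEquality Carrier
    card    : ℕ
    enum    : Fin card ⤖ Carrier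

  _-_ : Carrier → Carrier → Carrier
  x - y = x + (- y)

  w : Fin card → Carrier
  w = Bijection.to enum

  -- nonzero squares Q; N₀ = complement of Q (non-squares together with 0)
  IsSquare : Carrier → Set
  IsSquare x = ∃[ y ] (y * y ≡ x)

  InQ : Carrier → Set
  InQ x = (x ≢ 0#) × IsSquare x

  isSquare? : ∀ x → Dec (IsSquare x)
  isSquare? x with any? (λ i → (w i * w i) ≟ x)
  ... | yes (i , e) = yes (w i , e)
  ... | no ¬p = no λ { (y , e) → ¬p (helper y e (Bijection.strictlySurjective enum y)) }
    where
    helper : ∀ y → y * y ≡ x → ∃[ i ] (w i ≡ y) → ∃[ i ] (w i * w i ≡ x)
    helper y e (i , refl) = i , e

  InQ? : ∀ x → Dec (InQ x)
  InQ? x = ¬? (x ≟ 0#) ×-dec isSquare? x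

-- The q × (q+1) array T of the theorem (parameters a, b of the field).
-- Symbols: inj₁ x is x ∈ F_q, inj₂ x is the copy x′ ∈ F_q′.
-- Columns 0..q-1 correspond to j = 1..q, column q to j = q+1.
module _ (F : FiniteField) where
  open FiniteField F

  entryT : (a b : Carrier) → Fin card → Fin card → Carrier ⊎ Carrier
  entryT a b i j with InQ? (w i - w j)
  ... | yes _ = inj₁ (w i - (w i - w j) * (a ⁻¹))
  ... | no _  = inj₂ (w i + (w i - w j) * (b ⁻¹))

  T : (a b : Carrier) → Fin card → Fin (suc card) → Carrier ⊎ Carrier
  T a b i j with toℕ j <? card
  ... | yes p = entryT a b i (fromℕ< p)
  ... | no _  = inj₁ (w i)

module _ {r c : ℕ} {S : Set} (A : Fin r → Fin c → S) where
  InRow : Fin r → S → Set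
  InRow i s = ∃[ j ] (A i j ≡ s)

  InCol : Fin c → S → Set
  InCol j s = ∃[ i ] (A i j ≡ s)

-- Resolvability of an r × c array with v symbols (e = rc/v):
-- λ_rrc = e(e-1)/(r-1) and k = c/e are integers, and the symbols are
-- partitioned into r groups of size k (a bijection S ⤖ Fin r × Fin k;
-- the group of s is the first component) such that every column contains
-- exactly one symbol of each group, and the symbols of a group lie in
-- exactly the same rows.
Resolvable : (r c v : ℕ) {S : Set} → (Fin r → Fin c → S) → Set
Resolvable r c v {S} A =
  Σ ℕ λ e → (e N.* v ≡ r N.* c) ×
  (Σ ℕ λ λrrc → λrrc N.* (r ∸ 1) ≡ e N.* (e ∸ 1)) ×
  (Σ ℕ λ k → (k N.* e ≡ c) ×
    Σ (S ⤖ (Fin r × Fin k)) λ π →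
      let group : S → Fin r
          group s = proj₁ (Bijection.to π s)
      in (∀ (j : Fin c) (t : Fin r) → ∃! _≡_ (λ s → InCol A j s × group s ≡ t))
       × (∀ (s s′ : S) → group s ≡ group s′ → ∀ (i : Fin r) → InRow A i s ⇔ InRow A i s′))

{-# OPTIONS --safe #-}
-- The groups of the resolution are the pairs {y, y′}.  Put α = 1 − a⁻¹ and β = 1 + b⁻¹.  The
-- entry of column j ≤ q (u = w_j) in row x is u + (x − u)α if x − u ∈ Q and (u + (x − u)β)′
-- otherwise, so y lies in that column iff (y − u)α⁻¹ ∈ Q, and y′ iff (y − u)β⁻¹ ∉ Q; since
-- αβ = (a − 1)(b + 1)/(ab) ∈ Q, exactly one of them does.  Column q + 1 holds the unprimed
-- symbols.  Row x contains y iff y = x or −(y − x)a ∈ Q, and y′ iff (y − x)b ∉ Q; these agree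
-- because ab ∈ Q and, as q ≡ 3 (mod 4), −1 ∉ Q while e ∈ Q or −e ∈ Q for every e ≠ 0.  Both
-- facts are counting arguments: if i² = −1, or if neither e nor −e is a square, then
-- ⟨−1, y ↦ iy⟩, resp. ⟨−1, y ↦ e/y⟩, is a group of order 4 acting freely on F_q^*, which
-- forces 4 ∣ q − 1 (and −1 ≠ 1 because q is odd).
module Submission where

open import Defs
open import Data.Nat as N using (ℕ; suc; _≤_; _%_)
open import Data.Fin using (Fin; toℕ)
open import Relation.Binary.PropositionalEquality using (_≡_; _≢_)

open import Algebra.Bundles using (CommutativeRing)
open import Data.Bool.Base using (Bool; true; false; not)
open import Data.Empty using (⊥)
open import Data.Fin.Base using (zero; suc; _<_; fromℕ; inject₁)
open import Data.Fin.Patterns using (0F; 1F)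
open import Data.Fin.Permutation using (Permutation′; permutation)
open import Data.Fin.Properties
  using (_<?_; <-cmp; <-asym; toℕ-fromℕ; toℕ-fromℕ<; toℕ-inject₁; toℕ<n; toℕ-injective)
  renaming (_≟_ to _≟ᶠ_)
open import Data.Fin.Relation.Unary.Top using (view; ‵fromℕ; ‵inject₁)
import Data.Nat.Properties as ℕ
open import Data.Nat.Divisibility using (_∣_; divides; divides-refl; n∣m⇒m%n≡0)
open import Data.Nat.DivMod using (_/_; m≡m%n+[m/n]*n; m∣n⇒o%n%m≡o%m; [m+kn]%n≡m%n)
open import Data.Nat.Tactic.RingSolver using (solve-∀)
open import Data.Product using (Σ; ∃; ∃!; _×_; _,_; proj₁; proj₂)
open import Data.Product.Function.Dependent.Propositional using (Σ-⇔)
open import Data.Sum.Base using (_⊎_; inj₁; inj₂; [_,_]′)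
open import Data.Sum.Function.Propositional using (_⊎-⇔_)
open import Data.Sum.Properties using (inj₁-injective; inj₂-injective)
open import Data.Unit.Base using (⊤; tt)
open import Function.Base using (_∘_; id)
open import Function.Bundles
  using (_⤖_; _⇔_; Bijection; Surjection; Equivalence; mk⇔; mk↔ₛ′; mk↠ₛ)
open import Function.Construct.Composition using (_⇔-∘_)
open import Function.Construct.Symmetry using (⇔-sym)
open import Function.Definitions using (StrictlySurjective)
open import Function.Properties.Inverse using (↔⇒⤖)
open import Level using (0ℓ)
open import Relation.Binary.Definitions using (DecidableEquality; tri<; tri≈; tri>)
open import Relation.Binary.PropositionalEquality
  using (refl; sym; trans; cong; cong₂; subst; module ≡-Reasoning)
open import Relation.Nullary.Decidable
  using (Dec; yes; no; does; ¬?; _×-dec_; dec-true; dec-false; does-⇔)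
open import Relation.Nullary.Negation using (¬_; contradiction)
open import Relation.Unary using (Pred; Decidable)
open import Algebra.Properties.CommutativeMonoid.Sum ℕ.+-0-commutativeMonoid
  using (sum; sum-cong-≗; sum-permute; ∑-distrib-+; sum-replicate-zero)

-- Counting in a finite type

𝟙 : Bool → ℕ
𝟙 true  = 1
𝟙 false = 0

𝟙-does-yes : ∀ {P : Set} (P? : Dec P) → P → 𝟙 (does P?) ≡ 1
𝟙-does-yes P? p = cong 𝟙 (dec-true P? p)

𝟙-does-no : ∀ {P : Set} (P? : Dec P) → ¬ P → 𝟙 (does P?) ≡ 0
𝟙-does-no P? ¬p = cong 𝟙 (dec-false P? ¬p)

sum-1 : ∀ n → sum {n} (λ _ → 1) ≡ n
sum-1 N.zero    = refl
sum-1 (N.suc n) = cong N.suc (sum-1 n)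

sum-𝟙-≟ : ∀ {n} (k : Fin n) → sum (λ i → 𝟙 (does (i ≟ᶠ k))) ≡ 1
sum-𝟙-≟ {N.suc n} zero    = cong N.suc (sum-replicate-zero n)
sum-𝟙-≟ {N.suc n} (suc k) = sum-𝟙-≟ k

module Counting {A : Set} {m : ℕ} (enum : Fin m ⤖ A) where
  open import Data.Nat.Base using (_+_; _*_)
  open Bijection enum using (to; injective; surjection)
  open Surjection surjection using (to⁻; to∘to⁻)
  open ≡-Reasoning

  to⁻∘to : ∀ i → to⁻ (to i) ≡ i
  to⁻∘to i = injective (to∘to⁻ (to i))

  to⁻-injective : ∀ {x y} → to⁻ x ≡ to⁻ y → x ≡ y
  to⁻-injective {x} {y} eq = trans (sym (to∘to⁻ x)) (trans (cong to eq) (to∘to⁻ y))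

  count : {P : Pred A 0ℓ} → Decidable P → ℕ
  count P? = sum (λ i → 𝟙 (does (P? (to i))))

  count-all : count {P = λ _ → ⊤} (λ _ → yes tt) ≡ m
  count-all = sum-1 m

  count-∘-inverse : ∀ {P : Pred A 0ℓ} (P? : Decidable P) (f g : A → A) →
                    (∀ x → f (g x) ≡ x) → (∀ x → g (f x) ≡ x) → count (P? ∘ f) ≡ count P?
  count-∘-inverse P? f g f∘g g∘f = sym (begin
    count P?                                             ≡⟨ sum-permute _ π ⟩
    sum {m} (λ i → 𝟙 (does (P? (to (to⁻ (f (to i)))))))
      ≡⟨ sum-cong-≗ {m} (cong (𝟙 ∘ does ∘ P?) ∘ to∘to⁻ ∘ f ∘ to) ⟩
    count (P? ∘ f)                                       ∎)
    where
    lift : (h k : A → A) → (∀ x → h (k x) ≡ x) → ∀ i → to⁻ (h (to (to⁻ (k (to i))))) ≡ i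
    lift h k h∘k i = trans (cong (to⁻ ∘ h) (to∘to⁻ _)) (trans (cong to⁻ (h∘k (to i))) (to⁻∘to i))
    π : Permutation′ m
    π = permutation (λ i → to⁻ (f (to i))) (λ i → to⁻ (g (to i))) (lift f g f∘g) (lift g f g∘f)

  count-complement : ∀ {P : Pred A 0ℓ} (P? : Decidable P) → count P? + count (¬? ∘ P?) ≡ m
  count-complement P? = begin
    count P? + count (¬? ∘ P?)                                      ≡⟨ ∑-distrib-+ {m} _ _ ⟨
    sum (λ i → 𝟙 (does (P? (to i))) + 𝟙 (not (does (P? (to i)))))
      ≡⟨ sum-cong-≗ {m} (𝟙+𝟙-not ∘ does ∘ P? ∘ to) ⟩
    sum {m} (λ _ → 1)                                               ≡⟨ sum-1 m ⟩
    m                                                               ∎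
    where
    𝟙+𝟙-not : ∀ b → 𝟙 b + 𝟙 (not b) ≡ 1
    𝟙+𝟙-not true  = refl
    𝟙+𝟙-not false = refl

  count-≡ : (_≟_ : DecidableEquality A) (c : A) → count (_≟ c) ≡ 1
  count-≡ _≟_ c = trans (sum-cong-≗ {m} λ i → cong 𝟙 (does-⇔ (to≡c⇔ i) (to i ≟ c) (i ≟ᶠ to⁻ c)))
                        (sum-𝟙-≟ (to⁻ c))
    where
    to≡c⇔ : ∀ i → to i ≡ c ⇔ i ≡ to⁻ c
    to≡c⇔ i = mk⇔ (λ { refl → sym (to⁻∘to i) }) (λ { refl → to∘to⁻ c })

  count-≢ : (_≟_ : DecidableEquality A) (c : A) → suc (count (λ x → ¬? (x ≟ c))) ≡ m
  count-≢ _≟_ c =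
    trans (cong (_+ count (λ x → ¬? (x ≟ c))) (sym (count-≡ _≟_ c))) (count-complement (_≟ c))

  -- Rep selects one member of each pair {x, σ x}.
  module Pairing {X : Pred A 0ℓ} (X? : Decidable X) (σ : A → A)
                 (σ-X : ∀ {x} → X x → X (σ x)) (σ-σ : ∀ {x} → X x → σ (σ x) ≡ x)
                 (σ-free : ∀ {x} → X x → σ x ≢ x) where

    Rep : Pred A 0ℓ
    Rep x = X x × to⁻ x < to⁻ (σ x)

    Rep? : Decidable Rep
    Rep? x = X? x ×-dec (to⁻ x <? to⁻ (σ x))

    Rep⊎Rep∘σ : ∀ {x} → X x → Rep x ⊎ Rep (σ x)
    Rep⊎Rep∘σ {x} Xx with <-cmp (to⁻ x) (to⁻ (σ x))
    ... | tri< lt _ _ = inj₁ (Xx , lt)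
    ... | tri≈ _ eq _ = contradiction (sym (to⁻-injective eq)) (σ-free Xx)
    ... | tri> _ _ gt = inj₂ (σ-X Xx , subst (to⁻ (σ x) <_) (cong to⁻ (sym (σ-σ Xx))) gt)

    Rep⇒¬Rep∘σ : ∀ {x} → Rep x → ¬ Rep (σ x)
    Rep⇒¬Rep∘σ (Xx , lt) (_ , lt′) = <-asym lt (subst (to⁻ (σ _) <_) (cong to⁻ (σ-σ Xx)) lt′)

    -- A permutation of A agreeing with σ on X, so that counts can be reindexed along it.
    σ̂ : A → A
    σ̂ x with X? x
    ... | yes _ = σ x
    ... | no  _ = x

    σ̂-in : ∀ {x} → X x → σ̂ x ≡ σ x
    σ̂-in {x} Xx with X? x
    ... | yes _  = refl
    ... | no ¬Xx = contradiction Xx ¬Xx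

    σ̂-out : ∀ {x} → ¬ X x → σ̂ x ≡ x
    σ̂-out {x} ¬Xx with X? x
    ... | yes Xx = contradiction Xx ¬Xx
    ... | no  _  = refl

    σ̂-σ̂ : ∀ x → σ̂ (σ̂ x) ≡ x
    σ̂-σ̂ x with X? x
    ... | yes Xx = trans (σ̂-in (σ-X Xx)) (σ-σ Xx)
    ... | no ¬Xx = σ̂-out ¬Xx

    𝟙-X≡𝟙-Rep+𝟙-Rep∘σ̂ : ∀ x → 𝟙 (does (X? x)) ≡ 𝟙 (does (Rep? x)) + 𝟙 (does (Rep? (σ̂ x)))
    𝟙-X≡𝟙-Rep+𝟙-Rep∘σ̂ x = split (X? x) (Rep? x)
      where
      split : Dec (X x) → Dec (Rep x) → 𝟙 (does (X? x)) ≡ 𝟙 (does (Rep? x)) + 𝟙 (does (Rep? (σ̂ x)))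
      split (no ¬Xx) _ = trans (𝟙-does-no (X? x) ¬Xx) (sym (cong₂ _+_
        (𝟙-does-no (Rep? x) (¬Xx ∘ proj₁))
        (𝟙-does-no (Rep? (σ̂ x)) (¬Xx ∘ proj₁ ∘ subst Rep (σ̂-out ¬Xx)))))
      split (yes Xx) (yes r) = trans (𝟙-does-yes (X? x) Xx) (sym (cong₂ _+_
        (𝟙-does-yes (Rep? x) r)
        (𝟙-does-no (Rep? (σ̂ x)) (Rep⇒¬Rep∘σ r ∘ subst Rep (σ̂-in Xx)))))
      split (yes Xx) (no ¬r) with Rep⊎Rep∘σ Xx
      ... | inj₁ r  = contradiction r ¬r
      ... | inj₂ r′ = trans (𝟙-does-yes (X? x) Xx) (sym (cong₂ _+_
        (𝟙-does-no (Rep? x) ¬r)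
        (𝟙-does-yes (Rep? (σ̂ x)) (subst Rep (sym (σ̂-in Xx)) r′))))

    count-pairs : count X? ≡ 2 * count Rep?
    count-pairs = begin
      count X?                        ≡⟨ sum-cong-≗ {m} (𝟙-X≡𝟙-Rep+𝟙-Rep∘σ̂ ∘ to) ⟩
      sum (λ i → 𝟙 (does (Rep? (to i))) + 𝟙 (does (Rep? (σ̂ (to i)))))
                                      ≡⟨ ∑-distrib-+ {m} _ _ ⟩
      count Rep? + count (Rep? ∘ σ̂)   ≡⟨ cong (count Rep? +_) (count-∘-inverse Rep? σ̂ σ̂ σ̂-σ̂ σ̂-σ̂) ⟩
      count Rep? + count Rep?         ≡⟨ cong (count Rep? +_) (ℕ.+-identityʳ _) ⟨
      2 * count Rep?                  ∎

  2∣count : ∀ {X : Pred A 0ℓ} (X? : Decidable X) (σ : A → A) →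
            (∀ {x} → X x → X (σ x)) → (∀ {x} → X x → σ (σ x) ≡ x) → (∀ {x} → X x → σ x ≢ x) →
            2 ∣ count X?
  2∣count X? σ σ-X σ-σ σ-free = divides (count Rep?) (trans count-pairs (ℕ.*-comm 2 (count Rep?)))
    where open Pairing X? σ σ-X σ-σ σ-free

  -- σ and τ generate a group {1, σ, τ, στ} of order 4 acting freely on X (Klein if τ² = 1,
  -- cyclic if τ² = σ).  τ induces a free involution τ′ on the σ-pairs, so the pairs pair up.
  module _ {X : Pred A 0ℓ} (X? : Decidable X) (σ τ : A → A)
           (σ-X : ∀ {x} → X x → X (σ x)) (σ-σ : ∀ {x} → X x → σ (σ x) ≡ x)
           (σ-free : ∀ {x} → X x → σ x ≢ x)
           (τ-X : ∀ {x} → X x → X (τ x)) (τ-σ : ∀ {x} → X x → τ (σ x) ≡ σ (τ x))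
           (τ-τ : ∀ {x} → X x → τ (τ x) ≡ x ⊎ τ (τ x) ≡ σ x)
           (τ-free : ∀ {x} → X x → τ x ≢ x) (τ-free-σ : ∀ {x} → X x → τ x ≢ σ x) where

    open Pairing X? σ σ-X σ-σ σ-free

    private
      rep : A → A
      rep x with Rep? x
      ... | yes _ = x
      ... | no  _ = σ x

      rep-yes : ∀ {x} → Rep x → rep x ≡ x
      rep-yes {x} r with Rep? x
      ... | yes _ = refl
      ... | no ¬r = contradiction r ¬r

      rep-no : ∀ {x} → ¬ Rep x → rep x ≡ σ x
      rep-no {x} ¬r with Rep? x
      ... | yes r = contradiction r ¬r
      ... | no _  = refl

      rep-cases : ∀ x → rep x ≡ x ⊎ rep x ≡ σ x
      rep-cases x with Rep? x
      ... | yes _ = inj₁ refl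
      ... | no  _ = inj₂ refl

      rep-Rep : ∀ {x} → X x → Rep (rep x)
      rep-Rep {x} Xx with Rep? x | Rep⊎Rep∘σ Xx
      ... | yes r | _       = r
      ... | no ¬r | inj₁ r  = contradiction r ¬r
      ... | no _  | inj₂ r′ = r′

      rep-σ : ∀ {x} → X x → rep (σ x) ≡ rep x
      rep-σ {x} Xx with Rep? x
      ... | yes r = trans (rep-no (Rep⇒¬Rep∘σ r)) (σ-σ Xx)
      ... | no ¬r with Rep⊎Rep∘σ Xx
      ...   | inj₁ r  = contradiction r ¬r
      ...   | inj₂ r′ = rep-yes r′

      rep-pair : ∀ {x y} → X x → y ≡ x ⊎ y ≡ σ x → rep y ≡ rep x
      rep-pair Xx (inj₁ refl) = refl
      rep-pair Xx (inj₂ refl) = rep-σ Xx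

      τ′ : A → A
      τ′ x = rep (τ x)

      τ′-Rep : ∀ {x} → Rep x → Rep (τ′ x)
      τ′-Rep (Xx , _) = rep-Rep (τ-X Xx)

      τ′-τ′ : ∀ {x} → Rep x → τ′ (τ′ x) ≡ x
      τ′-τ′ {x} r@(Xx , _) = begin
        rep (τ (rep (τ x))) ≡⟨ rep-pair (τ-X (τ-X Xx)) τ-rep-τ ⟩
        rep (τ (τ x))       ≡⟨ rep-pair Xx (τ-τ Xx) ⟩
        rep x               ≡⟨ rep-yes r ⟩
        x                   ∎
        where
        τ-rep-τ : τ (rep (τ x)) ≡ τ (τ x) ⊎ τ (rep (τ x)) ≡ σ (τ (τ x))
        τ-rep-τ with rep-cases (τ x)
        ... | inj₁ eq = inj₁ (cong τ eq)
        ... | inj₂ eq = inj₂ (trans (cong τ eq) (τ-σ (τ-X Xx)))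

      τ′-free : ∀ {x} → Rep x → τ′ x ≢ x
      τ′-free {x} (Xx , _) with rep-cases (τ x)
      ... | inj₁ eq = τ-free Xx ∘ trans (sym eq)
      ... | inj₂ eq = λ eq′ → τ-free-σ Xx (begin
        τ x         ≡⟨ σ-σ (τ-X Xx) ⟨
        σ (σ (τ x)) ≡⟨ cong σ (trans (sym eq) eq′) ⟩
        σ x         ∎)

    4∣count : 4 ∣ count X?
    4∣count = divides (count Rep′?) (begin
      count X?               ≡⟨ count-pairs ⟩
      2 * count Rep?         ≡⟨ cong (2 *_) (Pairing.count-pairs Rep? τ′ τ′-Rep τ′-τ′ τ′-free) ⟩
      2 * (2 * count Rep′?)  ≡⟨ ℕ.*-assoc 2 2 (count Rep′?) ⟨
      4 * count Rep′?        ≡⟨ ℕ.*-comm 4 (count Rep′?) ⟩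
      count Rep′? * 4        ∎)
      where open Pairing Rep? τ′ τ′-Rep τ′-τ′ τ′-free using () renaming (Rep? to Rep′?)

≡3-mod-4⇒¬2∣ : ∀ {n} → n % 4 ≡ 3 → ¬ 2 ∣ n
≡3-mod-4⇒¬2∣ {n} n%4≡3 2∣n = contradiction 3%2≡0 λ ()
  where
  3%2≡0 : 3 % 2 ≡ 0
  3%2≡0 = trans (cong (_% 2) (sym n%4≡3))
                (trans (m∣n⇒o%n%m≡o%m 2 4 n (divides 2 refl)) (n∣m⇒m%n≡0 n 2 2∣n))

≡3-mod-4⇒¬4∣pred : ∀ {n} → suc n % 4 ≡ 3 → ¬ 4 ∣ n
≡3-mod-4⇒¬4∣pred n+1%4≡3 (divides-refl k) = contradiction (trans (sym n+1%4≡3) ([m+kn]%n≡m%n 1 k 4)) λ ()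

-- For q = 4h + 3: e = (q + 1)/2 = 2h + 2 and λ_rrc = e(e − 1)/(q − 1) = h + 1.
triple-array-parameters : ∀ {q} h → q ≡ 3 N.+ h N.* 4 →
  2 N.* (2 N.+ h N.* 2) ≡ suc q × (1 N.+ h) N.* (q N.∸ 1) ≡ (2 N.+ h N.* 2) N.* ((2 N.+ h N.* 2) N.∸ 1)
triple-array-parameters h refl = e-identity h , λ-identity h
  where
  e-identity : ∀ h → 2 N.* (2 N.+ h N.* 2) ≡ 4 N.+ h N.* 4
  e-identity = solve-∀
  λ-identity : ∀ h → (1 N.+ h) N.* (2 N.+ h N.* 4) ≡ (2 N.+ h N.* 2) N.* (1 N.+ h N.* 2)
  λ-identity = solve-∀

resolvable-by-copies : ∀ {S : Set} {r c : ℕ} (ι : Fin r ⤖ S) (A : Fin r → Fin c → S ⊎ S) (e λrrc : ℕ) →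
  2 N.* e ≡ c → λrrc N.* (r N.∸ 1) ≡ e N.* (e N.∸ 1) →
  (∀ j y → InCol A j (inj₁ y) ⊎ InCol A j (inj₂ y)) →
  (∀ j y → InCol A j (inj₁ y) → ¬ InCol A j (inj₂ y)) →
  (∀ i y → InRow A i (inj₁ y) ⇔ InRow A i (inj₂ y)) →
  Resolvable r c (r N.+ r) A
resolvable-by-copies {S} {r} {c} ι A e λrrc 2e≡c λ-eq InCol-inj₁⊎inj₂ InCol-inj₁⇒¬inj₂ InRow-inj₁⇔inj₂ =
  e , e*2r≡r*c , (λrrc , λ-eq) , 2 , 2e≡c , π , columns , rows
  where
  open Bijection ι using (to; surjection)
  open Surjection surjection using (to⁻; to∘to⁻)
  open Counting ι using (to⁻∘to; to⁻-injective)

  e*2r≡r*c : e N.* (r N.+ r) ≡ r N.* c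
  e*2r≡r*c = trans (e*[r+r]≡r*[2*e] e r) (cong (r N.*_) 2e≡c)
    where
    e*[r+r]≡r*[2*e] : ∀ e r → e N.* (r N.+ r) ≡ r N.* (2 N.* e)
    e*[r+r]≡r*[2*e] = solve-∀

  classify : S ⊎ S → Fin r × Fin 2
  classify (inj₁ y) = to⁻ y , 0F
  classify (inj₂ y) = to⁻ y , 1F

  unclassify : Fin r × Fin 2 → S ⊎ S
  unclassify (i , 0F) = inj₁ (to i)
  unclassify (i , 1F) = inj₂ (to i)

  π : (S ⊎ S) ⤖ (Fin r × Fin 2)
  π = ↔⇒⤖ (mk↔ₛ′ classify unclassify classify∘unclassify unclassify∘classify)
    where
    classify∘unclassify : ∀ p → classify (unclassify p) ≡ p
    classify∘unclassify (i , 0F) = cong (_, 0F) (to⁻∘to i)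
    classify∘unclassify (i , 1F) = cong (_, 1F) (to⁻∘to i)
    unclassify∘classify : ∀ s → unclassify (classify s) ≡ s
    unclassify∘classify (inj₁ y) = cong inj₁ (to∘to⁻ y)
    unclassify∘classify (inj₂ y) = cong inj₂ (to∘to⁻ y)

  group : S ⊎ S → Fin r
  group s = proj₁ (classify s)

  group⁻¹ : ∀ {s t} → group s ≡ t → s ≡ inj₁ (to t) ⊎ s ≡ inj₂ (to t)
  group⁻¹ {inj₁ y} refl = inj₁ (cong inj₁ (sym (to∘to⁻ y)))
  group⁻¹ {inj₂ y} refl = inj₂ (cong inj₂ (sym (to∘to⁻ y)))

  columns : ∀ j t → ∃! _≡_ (λ s → InCol A j s × group s ≡ t)
  columns j t with InCol-inj₁⊎inj₂ j (to t)
  ... | inj₁ y∈ = inj₁ (to t) , (y∈ , to⁻∘to t) , unique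
    where
    unique : ∀ {s} → InCol A j s × group s ≡ t → inj₁ (to t) ≡ s
    unique {s} (s∈ , gs≡t) with group⁻¹ {s} gs≡t
    ... | inj₁ refl = refl
    ... | inj₂ refl = contradiction s∈ (InCol-inj₁⇒¬inj₂ j (to t) y∈)
  ... | inj₂ y′∈ = inj₂ (to t) , (y′∈ , to⁻∘to t) , unique
    where
    unique : ∀ {s} → InCol A j s × group s ≡ t → inj₂ (to t) ≡ s
    unique {s} (s∈ , gs≡t) with group⁻¹ {s} gs≡t
    ... | inj₁ refl = contradiction y′∈ (InCol-inj₁⇒¬inj₂ j (to t) s∈)
    ... | inj₂ refl = refl

  rows : ∀ s s′ → group s ≡ group s′ → ∀ i → InRow A i s ⇔ InRow A i s′
  rows (inj₁ y) (inj₁ _) gs≡gs′ i with refl ← to⁻-injective gs≡gs′ = mk⇔ id id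
  rows (inj₁ y) (inj₂ _) gs≡gs′ i with refl ← to⁻-injective gs≡gs′ = InRow-inj₁⇔inj₂ i y
  rows (inj₂ y) (inj₁ _) gs≡gs′ i with refl ← to⁻-injective gs≡gs′ = ⇔-sym (InRow-inj₁⇔inj₂ i y)
  rows (inj₂ y) (inj₂ _) gs≡gs′ i with refl ← to⁻-injective gs≡gs′ = mk⇔ id id

-- Finite fields and their squares

module FiniteFieldProperties (F : FiniteField) where
  open FiniteField F
  open ≡-Reasoning
  open Surjection (Bijection.surjection enum) using (to⁻; to∘to⁻)

  commutativeRing : CommutativeRing 0ℓ 0ℓ
  commutativeRing = record { isCommutativeRing = isCommutativeRing }

  open CommutativeRing commutativeRing
    using (+-assoc; +-comm; +-identityʳ; -‿inverseˡ; -‿inverseʳ;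
           *-assoc; *-comm; *-identityˡ; *-identityʳ; zeroˡ; distribˡ; distribʳ;
           ring; *-commutativeSemigroup)
  open import Algebra.Properties.Ring ring
    using (-‿involutive; -‿distribˡ-*; -‿distribʳ-*; -1*x≈-x; -0#≈0#; xyx⁻¹≈y; //-rightDividesˡ;
           ⁻¹-anti-homo‿-; +-identityʳ-unique; x∙y⁻¹≈ε⇒x≈y)
  open import Algebra.Properties.CommutativeSemigroup *-commutativeSemigroup using (interchange)

  private variable x y z c c′ p : Carrier

  x⁻¹*x≡1 : x ≢ 0# → x ⁻¹ * x ≡ 1#
  x⁻¹*x≡1 {x} x≢0 = trans (*-comm (x ⁻¹) x) (inverseʳ x x≢0)

  [x*c]*c′≡x : c * c′ ≡ 1# → (x * c) * c′ ≡ x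
  [x*c]*c′≡x {c} {c′} {x} cc′≡1 = trans (*-assoc x c c′) (trans (cong (x *_) cc′≡1) (*-identityʳ x))

  *-cancelʳ : x ≢ 0# → y * x ≡ z * x → y ≡ z
  *-cancelʳ {x} {y} {z} x≢0 eq = begin
    y                 ≡⟨ [x*c]*c′≡x (inverseʳ x x≢0) ⟨
    (y * x) * x ⁻¹    ≡⟨ cong (_* x ⁻¹) eq ⟩
    (z * x) * x ⁻¹    ≡⟨ [x*c]*c′≡x (inverseʳ x x≢0) ⟩
    z                 ∎

  *-≢0 : x ≢ 0# → y ≢ 0# → x * y ≢ 0#
  *-≢0 {x} {y} x≢0 y≢0 xy≡0 = x≢0 (*-cancelʳ y≢0 (trans xy≡0 (sym (zeroˡ y))))

  *-≢0ˡ : x * y ≢ 0# → x ≢ 0#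
  *-≢0ˡ {x} {y} xy≢0 x≡0 = xy≢0 (trans (cong (_* y) x≡0) (zeroˡ y))

  *-≢0ʳ : x * y ≢ 0# → y ≢ 0#
  *-≢0ʳ {x} {y} xy≢0 = *-≢0ˡ (xy≢0 ∘ trans (*-comm x y))

  ⁻¹-≢0 : x ≢ 0# → x ⁻¹ ≢ 0#
  ⁻¹-≢0 {x} x≢0 = *-≢0ʳ (λ xx⁻¹≡0 → 0≢1 (trans (sym xx⁻¹≡0) (inverseʳ x x≢0)))

  -‿≢0 : x ≢ 0# → - x ≢ 0#
  -‿≢0 {x} x≢0 -x≡0 = x≢0 (trans (sym (-‿involutive x)) (trans (cong -_ -x≡0) -0#≈0#))

  ⁻¹-unique : x * y ≡ 1# → x ⁻¹ ≡ y
  ⁻¹-unique {x} {y} xy≡1 = begin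
    x ⁻¹              ≡⟨ [x*c]*c′≡x xy≡1 ⟨
    (x ⁻¹ * x) * y    ≡⟨ cong (_* y) (x⁻¹*x≡1 x≢0) ⟩
    1# * y            ≡⟨ *-identityˡ y ⟩
    y                 ∎
    where
    x≢0 : x ≢ 0#
    x≢0 = *-≢0ˡ (λ xy≡0 → 0≢1 (trans (sym xy≡0) xy≡1))

  -x*-y≡x*y : ∀ x y → - x * - y ≡ x * y
  -x*-y≡x*y x y = begin
    - x * - y         ≡⟨ -‿distribʳ-* (- x) y ⟨
    - (- x * y)       ≡⟨ cong -_ (-‿distribˡ-* x y) ⟨
    - (- (x * y))     ≡⟨ -‿involutive (x * y) ⟩
    x * y             ∎

  -‿⁻¹ : x ≢ 0# → (- x) ⁻¹ ≡ - (x ⁻¹)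
  -‿⁻¹ {x} x≢0 = ⁻¹-unique (trans (-x*-y≡x*y x (x ⁻¹)) (inverseʳ x x≢0))

  ⁻¹-involutive : x ≢ 0# → (x ⁻¹) ⁻¹ ≡ x
  ⁻¹-involutive {x} x≢0 = ⁻¹-unique (x⁻¹*x≡1 x≢0)

  ⁻¹-distrib-* : x ≢ 0# → y ≢ 0# → (x * y) ⁻¹ ≡ x ⁻¹ * y ⁻¹
  ⁻¹-distrib-* {x} {y} x≢0 y≢0 = ⁻¹-unique (begin
    (x * y) * (x ⁻¹ * y ⁻¹)     ≡⟨ interchange x y (x ⁻¹) (y ⁻¹) ⟩
    (x * x ⁻¹) * (y * y ⁻¹)     ≡⟨ cong₂ _*_ (inverseʳ x x≢0) (inverseʳ y y≢0) ⟩
    1# * 1#                     ≡⟨ *-identityˡ 1# ⟩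
    1#                          ∎)

  [x+y]*x⁻¹≡1+y*x⁻¹ : x ≢ 0# → (x + y) * x ⁻¹ ≡ 1# + y * x ⁻¹
  [x+y]*x⁻¹≡1+y*x⁻¹ {x} {y} x≢0 = trans (distribʳ (x ⁻¹) x y) (cong (_+ y * x ⁻¹) (inverseʳ x x≢0))

  [x+y]-x≡y : ∀ x y → (x + y) - x ≡ y
  [x+y]-x≡y = xyx⁻¹≈y

  x+[y-x]≡y : ∀ x y → x + (y - x) ≡ y
  x+[y-x]≡y x y = trans (+-comm x (y - x)) (//-rightDividesˡ x y)

  x-[x-y]≡y : ∀ x y → x - (x - y) ≡ y
  x-[x-y]≡y x y = trans (cong (x +_) (⁻¹-anti-homo‿- x y)) (x+[y-x]≡y x y)

  x≡y⇔y-x≡0 : x ≡ y ⇔ y - x ≡ 0#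
  x≡y⇔y-x≡0 {x} {y} = mk⇔ (λ { refl → -‿inverseʳ x }) (λ y-x≡0 → sym (x∙y⁻¹≈ε⇒x≈y y x y-x≡0))

  x-y*z≡x+y*-z : ∀ x y z → x - y * z ≡ x + y * - z
  x-y*z≡x+y*-z x y z = cong (x +_) (-‿distribʳ-* y z)

  x+[x-u]*c≡u+[x-u]*[1+c] : ∀ x u c → x + (x - u) * c ≡ u + (x - u) * (1# + c)
  x+[x-u]*c≡u+[x-u]*[1+c] x u c = begin
    x + (x - u) * c                   ≡⟨ cong (_+ (x - u) * c) (x+[y-x]≡y u x) ⟨
    (u + (x - u)) + (x - u) * c       ≡⟨ +-assoc u (x - u) ((x - u) * c) ⟩
    u + ((x - u) + (x - u) * c)       ≡⟨ cong (λ v → u + (v + (x - u) * c)) (*-identityʳ (x - u)) ⟨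
    u + ((x - u) * 1# + (x - u) * c)  ≡⟨ cong (u +_) (distribˡ (x - u) 1# c) ⟨
    u + (x - u) * (1# + c)            ∎

  p+z*c≡y⇒z≡[y-p]*c′ : c * c′ ≡ 1# → p + z * c ≡ y → z ≡ (y - p) * c′
  p+z*c≡y⇒z≡[y-p]*c′ {c} {c′} {p} {z} {y} cc′≡1 eq = begin
    z                        ≡⟨ [x*c]*c′≡x cc′≡1 ⟨
    (z * c) * c′             ≡⟨ cong (_* c′) ([x+y]-x≡y p (z * c)) ⟨
    ((p + z * c) - p) * c′   ≡⟨ cong (λ v → (v - p) * c′) eq ⟩
    (y - p) * c′             ∎

  p+[y-p]*c′*c≡y : c * c′ ≡ 1# → p + ((y - p) * c′) * c ≡ y
  p+[y-p]*c′*c≡y {c} {c′} {p} {y} cc′≡1 =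
    trans (cong (p +_) ([x*c]*c′≡x (trans (*-comm c′ c) cc′≡1))) (x+[y-x]≡y p y)

  -- Locating y along a row or column whose i-th entry is p + f (w i) * c: as f (w i) runs
  -- through the whole field, y occurs exactly where f (w i) = (y − p)c⁻¹.
  ∃-affine : ∀ {E : Fin card → Set} {P : Carrier → Set} (f : Carrier → Carrier) {p c c′ y : Carrier} →
             StrictlySurjective _≡_ f → c * c′ ≡ 1# →
             (∀ {i} → E i ⇔ (P (f (w i)) × p + f (w i) * c ≡ y)) → ∃ E ⇔ P ((y - p) * c′)
  ∃-affine {P = P} f {p} {c} {c′} {y} f-surjective cc′≡1 E⇔ = solution ⇔-∘ Σ-⇔ (mk↠ₛ f∘w-surjective) E⇔
    where
    f∘w-surjective : StrictlySurjective _≡_ (f ∘ w)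
    f∘w-surjective d with f-surjective d
    ... | x , fx≡d = to⁻ x , trans (cong f (to∘to⁻ x)) fx≡d
    solution : (∃ λ d → P d × p + d * c ≡ y) ⇔ P ((y - p) * c′)
    solution = mk⇔ (λ (d , Pd , eq) → subst P (p+z*c≡y⇒z≡[y-p]*c′ cc′≡1 eq) Pd)
                   (λ Pd → (y - p) * c′ , Pd , p+[y-p]*c′*c≡y cc′≡1)

  InQ-* : InQ x → InQ y → InQ (x * y)
  InQ-* (x≢0 , s , refl) (y≢0 , t , refl) = *-≢0 x≢0 y≢0 , s * t , interchange s t s t

  InQ-square : x ≢ 0# → InQ (x * x)
  InQ-square x≢0 = *-≢0 x≢0 x≢0 , _ , refl

  InQ-1 : InQ 1#
  InQ-1 = subst InQ (*-identityˡ 1#) (InQ-square (0≢1 ∘ sym))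

  InQ-*-square⁻¹ : InQ (x * (c * c)) → InQ x
  InQ-*-square⁻¹ {x} {c} q = subst InQ ([x*c]*c′≡x cc*c⁻¹c⁻¹≡1) (InQ-* q (InQ-square (⁻¹-≢0 c≢0)))
    where
    c≢0 : c ≢ 0#
    c≢0 = *-≢0ˡ (*-≢0ʳ (proj₁ q))
    cc*c⁻¹c⁻¹≡1 : (c * c) * (c ⁻¹ * c ⁻¹) ≡ 1#
    cc*c⁻¹c⁻¹≡1 = trans (interchange c c (c ⁻¹) (c ⁻¹))
                   (trans (cong₂ _*_ (inverseʳ c c≢0) (inverseʳ c c≢0)) (*-identityˡ 1#))

  -- c ~ c′: c and c′ are nonzero and lie in the same coset of the squares.
  infix 4 _~_
  _~_ : Carrier → Carrier → Set
  c ~ c′ = InQ (c * c′)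

  ~-sym : c ~ c′ → c′ ~ c
  ~-sym {c} {c′} = subst InQ (*-comm c c′)

  ~-trans : x ~ c → c ~ c′ → x ~ c′
  ~-trans {x} {c} {c′} x~c c~c′ = InQ-*-square⁻¹ (subst InQ (begin
    (x * c) * (c * c′)   ≡⟨ cong ((x * c) *_) (*-comm c c′) ⟩
    (x * c) * (c′ * c)   ≡⟨ interchange x c c′ c ⟩
    (x * c′) * (c * c)   ∎) (InQ-* x~c c~c′))

  ~-⁻¹ : c ≢ 0# → c ~ c ⁻¹
  ~-⁻¹ {c} c≢0 = subst InQ (sym (inverseʳ c c≢0)) InQ-1

  ⁻¹-~ : c ~ c′ → c ⁻¹ ~ c′ ⁻¹
  ⁻¹-~ c~c′ = ~-trans (~-trans (~-sym (~-⁻¹ (*-≢0ˡ (proj₁ c~c′)))) c~c′) (~-⁻¹ (*-≢0ʳ (proj₁ c~c′)))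

  [1-a⁻¹]~[1+b⁻¹] : ∀ {a b} → a ~ b → InQ ((a - 1#) * (b + 1#)) → 1# - a ⁻¹ ~ 1# + b ⁻¹
  [1-a⁻¹]~[1+b⁻¹] {a} {b} a~b q = subst InQ (begin
    ((a - 1#) * (b + 1#)) * (a ⁻¹ * b ⁻¹)   ≡⟨ interchange (a - 1#) (b + 1#) (a ⁻¹) (b ⁻¹) ⟩
    ((a - 1#) * a ⁻¹) * ((b + 1#) * b ⁻¹)   ≡⟨ cong₂ _*_ ([x+y]*x⁻¹≡1+y*x⁻¹ (*-≢0ˡ (proj₁ a~b)))
                                                         ([x+y]*x⁻¹≡1+y*x⁻¹ (*-≢0ʳ (proj₁ a~b))) ⟩
    (1# + - 1# * a ⁻¹) * (1# + 1# * b ⁻¹)   ≡⟨ cong₂ (λ u v → (1# + u) * (1# + v))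
                                                         (-1*x≈-x (a ⁻¹)) (*-identityˡ (b ⁻¹)) ⟩
    (1# - a ⁻¹) * (1# + b ⁻¹)               ∎) (InQ-* q (⁻¹-~ a~b))

  module _ (card%4≡3 : card % 4 ≡ 3) where
    open Counting enum using (count-all; count-≢; 2∣count; 4∣count)

    1+1≢0 : 1# + 1# ≢ 0#
    1+1≢0 2≡0 = ≡3-mod-4⇒¬2∣ card%4≡3 (subst (2 ∣_) count-all
      (2∣count (λ _ → yes tt) (_+ 1#) (λ _ → tt) (λ {x} _ → +1+1 x) (λ {x} _ → +1≢id x)))
      where
      +1+1 : ∀ x → (x + 1#) + 1# ≡ x
      +1+1 x = trans (+-assoc x 1# 1#) (trans (cong (x +_) 2≡0) (+-identityʳ x))
      +1≢id : ∀ x → x + 1# ≢ x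
      +1≢id x eq = 0≢1 (sym (+-identityʳ-unique x 1# eq))

    -x≢x : x ≢ 0# → - x ≢ x
    -x≢x {x} x≢0 -x≡x = *-≢0 1+1≢0 x≢0 (begin
      (1# + 1#) * x    ≡⟨ distribʳ x 1# 1# ⟩
      1# * x + 1# * x  ≡⟨ cong₂ _+_ (*-identityˡ x) (*-identityˡ x) ⟩
      x + x            ≡⟨ cong (_+ x) -x≡x ⟨
      - x + x          ≡⟨ -‿inverseˡ x ⟩
      0#               ∎)

    no-free-order-4-action : (τ : Carrier → Carrier) →
      (∀ {x} → x ≢ 0# → τ x ≢ 0#) → (∀ {x} → x ≢ 0# → τ (- x) ≡ - τ x) →
      (∀ {x} → x ≢ 0# → τ (τ x) ≡ x ⊎ τ (τ x) ≡ - x) →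
      (∀ {x} → x ≢ 0# → τ x ≢ x) → (∀ {x} → x ≢ 0# → τ x ≢ - x) → ⊥
    no-free-order-4-action τ τ-≢0 τ-neg τ-τ τ-free τ-free-neg =
      ≡3-mod-4⇒¬4∣pred (subst (λ n → n % 4 ≡ 3) (sym (count-≢ _≟_ 0#)) card%4≡3)
        (4∣count (λ x → ¬? (x ≟ 0#)) -_ τ -‿≢0 (λ {x} _ → -‿involutive x) -x≢x
                 τ-≢0 τ-neg τ-τ τ-free τ-free-neg)

    -1∉Q : ¬ InQ (- 1#)
    -1∉Q (_ , i , i*i≡-1) =
      no-free-order-4-action (i *_) (*-≢0 i≢0) (λ {x} _ → sym (-‿distribʳ-* i x))
        (λ {x} _ → inj₂ (i*[i*x]≡-x x))
        (λ {x} x≢0 ix≡x → i≢1 (*-cancelʳ x≢0 (trans ix≡x (sym (*-identityˡ x)))))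
        (λ {x} x≢0 ix≡-x → i≢-1 (*-cancelʳ x≢0 (trans ix≡-x (sym (-1*x≈-x x)))))
      where
      -1≢1 : - 1# ≢ 1#
      -1≢1 = -x≢x (0≢1 ∘ sym)
      i≢0 : i ≢ 0#
      i≢0 i≡0 = -‿≢0 (0≢1 ∘ sym) (trans (sym i*i≡-1) (trans (cong (_* i) i≡0) (zeroˡ i)))
      i≢1 : i ≢ 1#
      i≢1 i≡1 = -1≢1 (trans (sym i*i≡-1) (trans (cong (λ j → j * j) i≡1) (*-identityˡ 1#)))
      i≢-1 : i ≢ - 1#
      i≢-1 i≡-1 = -1≢1 (begin
        - 1#          ≡⟨ i*i≡-1 ⟨
        i * i         ≡⟨ cong (λ j → j * j) i≡-1 ⟩
        - 1# * - 1#   ≡⟨ -x*-y≡x*y 1# 1# ⟩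
        1# * 1#       ≡⟨ *-identityˡ 1# ⟩
        1#            ∎)
      i*[i*x]≡-x : ∀ x → i * (i * x) ≡ - x
      i*[i*x]≡-x x = trans (sym (*-assoc i i x)) (trans (cong (_* x) i*i≡-1) (-1*x≈-x x))

    InQ⊎InQ-neg : x ≢ 0# → InQ x ⊎ InQ (- x)
    InQ⊎InQ-neg {e} e≢0 with InQ? e | InQ? (- e)
    ... | yes e∈Q | _        = inj₁ e∈Q
    ... | no _    | yes -e∈Q = inj₂ -e∈Q
    ... | no e∉Q  | no -e∉Q  =
      contradiction (no-free-order-4-action τ τ-≢0 τ-neg (inj₁ ∘ τ-τ) τ-free τ-free-neg) λ ()
      where
      τ : Carrier → Carrier
      τ x = e * x ⁻¹
      τ-≢0 : ∀ {x} → x ≢ 0# → τ x ≢ 0#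
      τ-≢0 x≢0 = *-≢0 e≢0 (⁻¹-≢0 x≢0)
      τ-neg : ∀ {x} → x ≢ 0# → τ (- x) ≡ - τ x
      τ-neg {x} x≢0 = trans (cong (e *_) (-‿⁻¹ x≢0)) (sym (-‿distribʳ-* e (x ⁻¹)))
      τ-τ : ∀ {x} → x ≢ 0# → τ (τ x) ≡ x
      τ-τ {x} x≢0 = begin
        e * (e * x ⁻¹) ⁻¹       ≡⟨ cong (e *_) (⁻¹-distrib-* e≢0 (⁻¹-≢0 x≢0)) ⟩
        e * (e ⁻¹ * x ⁻¹ ⁻¹)    ≡⟨ cong (λ y → e * (e ⁻¹ * y)) (⁻¹-involutive x≢0) ⟩
        e * (e ⁻¹ * x)          ≡⟨ *-assoc e (e ⁻¹) x ⟨
        (e * e ⁻¹) * x          ≡⟨ cong (_* x) (inverseʳ e e≢0) ⟩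
        1# * x                  ≡⟨ *-identityˡ x ⟩
        x                       ∎
      τ-free : ∀ {x} → x ≢ 0# → τ x ≢ x
      τ-free {x} x≢0 τx≡x = e∉Q (e≢0 , x , (begin
        x * x                   ≡⟨ cong (_* x) τx≡x ⟨
        (e * x ⁻¹) * x          ≡⟨ [x*c]*c′≡x (x⁻¹*x≡1 x≢0) ⟩
        e                       ∎))
      τ-free-neg : ∀ {x} → x ≢ 0# → τ x ≢ - x
      τ-free-neg {x} x≢0 τx≡-x = -e∉Q (-‿≢0 e≢0 , x , (begin
        x * x                   ≡⟨ -‿involutive (x * x) ⟨
        - (- (x * x))           ≡⟨ cong -_ (-‿distribˡ-* x x) ⟩
        - (- x * x)             ≡⟨ cong (λ y → - (y * x)) τx≡-x ⟨
        - ((e * x ⁻¹) * x)      ≡⟨ cong -_ ([x*c]*c′≡x (x⁻¹*x≡1 x≢0)) ⟩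
        - e                     ∎))

    InQ-neg⇔∉Q : x ≢ 0# → InQ (- x) ⇔ (¬ InQ x)
    InQ-neg⇔∉Q {x} x≢0 = mk⇔
      (λ -x∈Q x∈Q → -1∉Q (InQ-*-square⁻¹ (subst InQ -x*x≡-1*[x*x] (InQ-* -x∈Q x∈Q))))
      (λ x∉Q → [ (λ x∈Q → contradiction x∈Q x∉Q) , id ]′ (InQ⊎InQ-neg x≢0))
      where
      -x*x≡-1*[x*x] : - x * x ≡ - 1# * (x * x)
      -x*x≡-1*[x*x] = trans (sym (-‿distribˡ-* x x)) (sym (-1*x≈-x (x * x)))

    ≡0⊎InQ-neg⇔∉Q : c ~ c′ → (z ≡ 0# ⊎ InQ (z * - c)) ⇔ (¬ InQ (z * c′))
    ≡0⊎InQ-neg⇔∉Q {c} {c′} {z} c~c′ = mk⇔ to from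
      where
      to : z ≡ 0# ⊎ InQ (z * - c) → ¬ InQ (z * c′)
      to (inj₁ z≡0) (zc′≢0 , _) = zc′≢0 (trans (cong (_* c′) z≡0) (zeroˡ c′))
      to (inj₂ -zc∈Q) zc′∈Q =
        Equivalence.to (InQ-neg⇔∉Q (proj₁ zc∈Q)) (subst InQ (sym (-‿distribʳ-* z c)) -zc∈Q) zc∈Q
        where
        zc∈Q : InQ (z * c)
        zc∈Q = ~-trans zc′∈Q (~-sym c~c′)
      from : ¬ InQ (z * c′) → z ≡ 0# ⊎ InQ (z * - c)
      from zc′∉Q with z ≟ 0#
      ... | yes z≡0 = inj₁ z≡0
      ... | no z≢0  = inj₂ (subst InQ (-‿distribʳ-* z c)
                       (Equivalence.from (InQ-neg⇔∉Q (*-≢0 z≢0 (*-≢0ˡ (proj₁ c~c′))))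
                                         (zc′∉Q ∘ λ zc∈Q → ~-trans zc∈Q c~c′)))

-- The array T

∃-fromℕ⊎inject₁ : ∀ {n} {P : Fin (suc n) → Set} → ∃ P ⇔ (P (fromℕ n) ⊎ ∃ (P ∘ inject₁))
∃-fromℕ⊎inject₁ {n} {P} = mk⇔ split [ (fromℕ n ,_) , (λ (k , p) → inject₁ k , p) ]′
  where
  split : ∃ P → P (fromℕ n) ⊎ ∃ (P ∘ inject₁)
  split (j , p) with view j
  ... | ‵fromℕ     = inj₁ p
  ... | ‵inject₁ k = inj₂ (k , p)

module TripleArray (F : FiniteField) (a b : FiniteField.Carrier F) where
  open FiniteField F
  open FiniteFieldProperties F

  T-fromℕ : ∀ i → T F a b i (fromℕ card) ≡ inj₁ (w i)
  T-fromℕ i with toℕ (fromℕ card) N.<? card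
  ... | yes p = contradiction (subst (N._< card) (toℕ-fromℕ card) p) (ℕ.<-irrefl refl)
  ... | no _  = refl

  T-inject₁ : ∀ i k → T F a b i (inject₁ k) ≡ entryT F a b i k
  T-inject₁ i k with toℕ (inject₁ k) N.<? card
  ... | yes p = cong (entryT F a b i) (toℕ-injective (trans (toℕ-fromℕ< p) (toℕ-inject₁ k)))
  ... | no ¬p = contradiction (subst (N._< card) (sym (toℕ-inject₁ k)) (toℕ<n k)) ¬p

  T≡inj₁⇔ : ∀ i k {y} →
            T F a b i (inject₁ k) ≡ inj₁ y ⇔ (InQ (w i - w k) × w i - (w i - w k) * a ⁻¹ ≡ y)
  T≡inj₁⇔ i k rewrite T-inject₁ i k with InQ? (w i - w k)
  ... | yes d∈Q = mk⇔ (λ eq → d∈Q , inj₁-injective eq) (cong inj₁ ∘ proj₂)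
  ... | no d∉Q  = mk⇔ (λ ()) (λ (d∈Q , _) → contradiction d∈Q d∉Q)

  T≡inj₂⇔ : ∀ i k {y} →
            T F a b i (inject₁ k) ≡ inj₂ y ⇔ (¬ InQ (w i - w k) × w i + (w i - w k) * b ⁻¹ ≡ y)
  T≡inj₂⇔ i k rewrite T-inject₁ i k with InQ? (w i - w k)
  ... | yes d∈Q = mk⇔ (λ ()) (λ (d∉Q , _) → contradiction d∈Q d∉Q)
  ... | no d∉Q  = mk⇔ (λ eq → d∉Q , inj₂-injective eq) (cong inj₂ ∘ proj₂)

  ×-≡-⇔ : ∀ {Q : Set} {v v′ y : Carrier} → v ≡ v′ → (Q × v ≡ y) ⇔ (Q × v′ ≡ y)
  ×-≡-⇔ refl = mk⇔ id id

  module Occurrences (card%4≡3 : card % 4 ≡ 3) (a≢0 : a ≢ 0#) (b≢0 : b ≢ 0#)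
                     ([a-1][b+1]∈Q : InQ ((a - 1#) * (b + 1#))) (ab∈Q : InQ (a * b)) where
    open Surjection (Bijection.surjection enum) using (to⁻; to∘to⁻)

    α β : Carrier
    α = 1# - a ⁻¹
    β = 1# + b ⁻¹

    α~β : α ~ β
    α~β = [1-a⁻¹]~[1+b⁻¹] ab∈Q [a-1][b+1]∈Q

    InCol-inj₁⇔ : ∀ k y → InCol (T F a b) (inject₁ k) (inj₁ y) ⇔ InQ ((y - w k) * α ⁻¹)
    InCol-inj₁⇔ k y = ∃-affine {P = InQ} (_- w k) (λ d → w k + d , [x+y]-x≡y (w k) d)
      (inverseʳ α (*-≢0ˡ (proj₁ α~β)))
      (λ {i} → ×-≡-⇔ (trans (x-y*z≡x+y*-z (w i) (w i - w k) (a ⁻¹))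
                             (x+[x-u]*c≡u+[x-u]*[1+c] (w i) (w k) (- a ⁻¹)))
               ⇔-∘ T≡inj₁⇔ i k)

    InCol-inj₂⇔ : ∀ k y → InCol (T F a b) (inject₁ k) (inj₂ y) ⇔ (¬ InQ ((y - w k) * β ⁻¹))
    InCol-inj₂⇔ k y = ∃-affine {P = ¬_ ∘ InQ} (_- w k) (λ d → w k + d , [x+y]-x≡y (w k) d)
      (inverseʳ β (*-≢0ʳ (proj₁ α~β)))
      (λ {i} → ×-≡-⇔ (x+[x-u]*c≡u+[x-u]*[1+c] (w i) (w k) (b ⁻¹)) ⇔-∘ T≡inj₂⇔ i k)

    InRow-inj₁⇔ : ∀ i y → InRow (T F a b) i (inj₁ y) ⇔ (y - w i ≡ 0# ⊎ InQ ((y - w i) * - a))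
    InRow-inj₁⇔ i y = (last-column ⊎-⇔ other-columns) ⇔-∘ ∃-fromℕ⊎inject₁
      where
      last-column : T F a b i (fromℕ card) ≡ inj₁ y ⇔ (y - w i ≡ 0#)
      last-column rewrite T-fromℕ i = x≡y⇔y-x≡0 ⇔-∘ mk⇔ inj₁-injective (cong inj₁)
      other-columns : (∃ λ k → T F a b i (inject₁ k) ≡ inj₁ y) ⇔ InQ ((y - w i) * - a)
      other-columns = ∃-affine {P = InQ} (λ u → w i - u) (λ d → w i - d , x-[x-y]≡y (w i) d)
        (trans (-x*-y≡x*y (a ⁻¹) a) (x⁻¹*x≡1 a≢0))
        (λ {k} → ×-≡-⇔ (x-y*z≡x+y*-z (w i) (w i - w k) (a ⁻¹)) ⇔-∘ T≡inj₁⇔ i k)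

    InRow-inj₂⇔ : ∀ i y → InRow (T F a b) i (inj₂ y) ⇔ (¬ InQ ((y - w i) * b))
    InRow-inj₂⇔ i y = other-columns ⇔-∘ (mk⇔ [ last-column , id ]′ inj₂ ⇔-∘ ∃-fromℕ⊎inject₁)
      where
      last-column : T F a b i (fromℕ card) ≡ inj₂ y → ∃ λ k → T F a b i (inject₁ k) ≡ inj₂ y
      last-column eq = contradiction (trans (sym (T-fromℕ i)) eq) λ ()
      other-columns : (∃ λ k → T F a b i (inject₁ k) ≡ inj₂ y) ⇔ (¬ InQ ((y - w i) * b))
      other-columns = ∃-affine {P = ¬_ ∘ InQ} (λ u → w i - u) (λ d → w i - d , x-[x-y]≡y (w i) d)
        (x⁻¹*x≡1 b≢0) (T≡inj₂⇔ i _)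

    InRow-inj₁⇔inj₂ : ∀ i y → InRow (T F a b) i (inj₁ y) ⇔ InRow (T F a b) i (inj₂ y)
    InRow-inj₁⇔inj₂ i y = ⇔-sym (InRow-inj₂⇔ i y) ⇔-∘ (≡0⊎InQ-neg⇔∉Q card%4≡3 ab∈Q ⇔-∘ InRow-inj₁⇔ i y)

    InCol-inj₁⊎inj₂ : ∀ j y → InCol (T F a b) j (inj₁ y) ⊎ InCol (T F a b) j (inj₂ y)
    InCol-inj₁⊎inj₂ j y with view j
    ... | ‵fromℕ = inj₁ (to⁻ y , trans (T-fromℕ (to⁻ y)) (cong inj₁ (to∘to⁻ y)))
    ... | ‵inject₁ k with InQ? ((y - w k) * α ⁻¹)
    ...   | yes q = inj₁ (Equivalence.from (InCol-inj₁⇔ k y) q)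
    ...   | no ¬q = inj₂ (Equivalence.from (InCol-inj₂⇔ k y) (¬q ∘ λ q′ → ~-trans q′ (⁻¹-~ (~-sym α~β))))

    InCol-inj₁⇒¬inj₂ : ∀ j y → InCol (T F a b) j (inj₁ y) → ¬ InCol (T F a b) j (inj₂ y)
    InCol-inj₁⇒¬inj₂ j y y∈ (i , eq) with view j
    ... | ‵fromℕ     = contradiction (trans (sym (T-fromℕ i)) eq) λ ()
    ... | ‵inject₁ k = Equivalence.to (InCol-inj₂⇔ k y) (i , eq)
                         (~-trans (Equivalence.to (InCol-inj₁⇔ k y) y∈) (⁻¹-~ α~β))

theorem8 : (F : FiniteField) → let open FiniteField F in
    IsPrimePower card → 7 ≤ card → card % 4 ≡ 3 →
    (∀ (i : Fin card) → toℕ i ≡ 0 → w i ≡ 0#) →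
    (a b : Carrier) → a ≢ 0# → b ≢ 0# →
    InQ ((a - 1#) * (b + 1#)) →
    InQ (a * b) →
    Resolvable card (suc card) (card N.+ card) (T F a b)
theorem8 F _ _ card%4≡3 _ a b a≢0 b≢0 [a-1][b+1]∈Q ab∈Q =
  resolvable-by-copies enum (T F a b) (2 N.+ h N.* 2) (1 N.+ h) e-eq λ-eq
    InCol-inj₁⊎inj₂ InCol-inj₁⇒¬inj₂ InRow-inj₁⇔inj₂
  where
  open FiniteField F
  open TripleArray.Occurrences F a b card%4≡3 a≢0 b≢0 [a-1][b+1]∈Q ab∈Q
  h : ℕ
  h = card / 4
  card≡3+h*4 : card ≡ 3 N.+ h N.* 4
  card≡3+h*4 = trans (m≡m%n+[m/n]*n card 4) (cong (N._+ h N.* 4) card%4≡3)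
  open Σ (triple-array-parameters h card≡3+h*4) renaming (proj₁ to e-eq; proj₂ to λ-eq)
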